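{- Let $[\ell,u]$ be a thin degree sequence interval on $n$ vertices and let $X,Y\in\mathcal{G}(\ell,u)$. Then $$|S_{X,Y}|=\prod_{v\in[n]}\left(\left\lceil\frac{\deg_{\nabla_{X,Y}}(v)}{2}\right\rceil\right)!,$$ where $\deg_{\nabla_{X,Y}}(v)$ is the number of pairs in $\nabla_{X,Y}$ containing $v$.
   Context: Graphs are simple on vertex set $[n]$. A degree sequence is $d\in\mathbb{N}^n$ with coordinates at most $n-1$; for degree sequences $\ell\le u$, $\mathcal{G}(\ell,u)$ is the set of graphs on $[n]$ with degree sequence $d$ satisfying $\ell\le d\le u$ coordinatewise; $[\ell,u]$ is thin if $u_i\le\ell_i+1$ for all $i$. For $\nabla\subseteq\binom{[n]}{2}$, $\nabla_v=\{e\in\nabla:v\in e\}$; a pairing function on $\nabla$ is a map $s:\{(v,e):v\in e\in\nabla\}\to\nabla$ such that for each $v$, $e\mapsto s(v,e)$ is an involution of $\nabla_v$; $\Pi(\nabla)$ is the set of pairing functions. For a graph $Z$, $s\in\Pi(\nabla)$ is $Z$-alternating if for every $v\in e\in\nabla$ either $e$ is the unique fixpoint of $s(v,\cdot)$ (so $s(v,\cdot)$ has at most one fixpoint), or $e\in E(Z)$ and $s(v,e)\notin E(Z)$, or $e\notin E(Z)$ and $s(v,e)\in E(Z)$. With $\nabla_{X,Y}=E(X)\triangle E(Y)$, $S_{X,Y}$ is the set of $s\in\Pi(\nabla_{X,Y})$ that are both $X$-alternating and $Y$-alternating. -}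

module Defs where

open import Data.Nat using (ℕ; zero; suc; _+_; _*_; _∸_; _≤_; ⌈_/2⌉; _!)
open import Data.Bool using (Bool; true; false; T; _xor_; not)
open import Data.Fin using (Fin; zero; suc)
open import Data.Vec using (Vec; lookup)
open import Data.Product using (Σ; _×_; ∃)
open import Data.Sum using (_⊎_)
open import Relation.Binary.PropositionalEquality using (_≡_)
open import Relation.Nullary using (¬_)

countFin : ∀ {n} → (Fin n → Bool) → ℕ
countFin {zero}  p = 0
countFin {suc n} p = (if' (p zero)) + countFin (λ i → p (suc i))
  where
  if' : Bool → ℕ
  if' true  = 1
  if' false = 0

prodFin : ∀ {n} → (Fin n → ℕ) → ℕ
prodFin {zero}  f = 1
prodFin {suc n} f = f zero * prodFin (λ i → f (suc i))

record Graph (n : ℕ) : Set where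
  field
    adj     : Fin n → Fin n → Bool
    symm    : ∀ v w → adj v w ≡ adj w v
    irrefl  : ∀ v → adj v v ≡ false
open Graph public

deg : ∀ {n} → Graph n → Fin n → ℕ
deg G v = countFin (adj G v)

IsDegSeq : ∀ {n} → (Fin n → ℕ) → Set
IsDegSeq {n} d = ∀ i → d i ≤ n ∸ 1

_≤ᵖ_ : ∀ {n} → (Fin n → ℕ) → (Fin n → ℕ) → Set
ℓ ≤ᵖ u = ∀ i → ℓ i ≤ u i

Thin : ∀ {n} → (Fin n → ℕ) → (Fin n → ℕ) → Set
Thin ℓ u = ∀ i → u i ≤ ℓ i + 1

InG : ∀ {n} → (Fin n → ℕ) → (Fin n → ℕ) → Graph n → Set
InG ℓ u X = ∀ v → ℓ v ≤ deg X v × deg X v ≤ u v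

-- ∇_{X,Y} = E(X) △ E(Y): pair {v,w} is in ∇ iff nabla X Y v w = true
nabla : ∀ {n} → Graph n → Graph n → Fin n → Fin n → Bool
nabla X Y v w = adj X v w xor adj Y v w

degNabla : ∀ {n} → Graph n → Graph n → Fin n → ℕ
degNabla X Y v = countFin (nabla X Y v)

-- Encoding of a pairing function s on ∇: a table T with
-- s(v,{v,w}) = {v, T v w}.  Entries with {v,w} ∉ ∇ are normalised to w.
Table : ℕ → Set
Table n = Vec (Vec (Fin n) n) n

app : ∀ {n} → Table n → Fin n → Fin n → Fin n
app t v w = lookup (lookup t v) w

IsPairing : ∀ {n} → (Fin n → Fin n → Bool) → Table n → Set
IsPairing {n} N t =
  (∀ v w → ¬ T (N v w) → app t v w ≡ w) ×
  (∀ v w → T (N v w) → T (N v (app t v w)) × app t v (app t v w) ≡ w)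

IsAlternating : ∀ {n} → (Fin n → Fin n → Bool) → (Fin n → Fin n → Bool) → Table n → Set
IsAlternating {n} N Z t =
  ∀ v w → T (N v w) →
    (app t v w ≡ w × (∀ w' → T (N v w') → app t v w' ≡ w' → w' ≡ w))
    ⊎ (T (Z v w) × ¬ T (Z v (app t v w)))
    ⊎ (¬ T (Z v w) × T (Z v (app t v w)))

InS : ∀ {n} → Graph n → Graph n → Table n → Set
InS X Y t = IsPairing (nabla X Y) t
          × IsAlternating (nabla X Y) (adj X) t
          × IsAlternating (nabla X Y) (adj Y) t

HasCard : {A : Set} → (A → Set) → ℕ → Set
HasCard {A} P k =
  Σ (Fin k → A) λ f →
    (∀ i → P (f i)) ×
    (∀ i j → f i ≡ f j → i ≡ j) ×
    (∀ a → P a → ∃ λ i → f i ≡ a)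

{-# OPTIONS --safe #-}

-- An element of S_{X,Y} amounts to choosing, independently at each vertex v, an involution
-- of ∇_v with at most one fixpoint that pairs edges of X with edges of Y; alternation with
-- respect to Y is then automatic because ∇ = E(X) △ E(Y). If ∇_v consists of a edges of X
-- and b edges of Y, then deg_X v = c + a and deg_Y v = c + b both lie in [ℓ v, ℓ v + 1], so
-- |a − b| ≤ 1. Following one labelled edge e (it is the fixpoint, or it is paired with one of
-- the edges of the other kind) gives k! such involutions when a = b = k and (k+1)! when
-- {a, b} = {k, k+1}, which is ⌈(a+b)/2⌉! in both cases.

module Submission where

open import Defs
open import Data.Bool using (Bool; true; false; T; not; _∧_; _xor_; if_then_else_)
open import Data.Bool.Properties using (∧-comm; not-involutive; not-¬) renaming (_≟_ to _≟ᵇ_)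
open import Data.Empty using (⊥-elim)
open import Data.Fin using (Fin; zero; suc; _≟_; splitAt; _↑ˡ_; _↑ʳ_; combine; remQuot)
open import Data.Fin.Properties
  using (suc-injective; splitAt-↑ˡ; splitAt-↑ʳ; splitAt⁻¹-↑ˡ; splitAt⁻¹-↑ʳ; remQuot-combine; combine-remQuot)
open import Data.Maybe using (Maybe; just; nothing)
open import Data.Maybe.Properties using (≡-dec; just-injective)
open import Data.Nat using (ℕ; zero; suc; pred; _+_; _*_; _≤_; _!; ⌈_/2⌉; s≤s⁻¹)
open import Data.Nat.Properties
  using ( +-suc; +-comm; *-zeroʳ; +-monoˡ-≤; +-cancelˡ-≤; ≤-antisym; m≤n⇒m<n∨m≡n
        ; n≡⌈n+n/2⌉; n≡⌊n+n/2⌋; module ≤-Reasoning)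
open import Data.Product using (_×_; ∃; _,_; proj₁; proj₂; uncurry)
open import Data.Sum using (_⊎_; inj₁; inj₂)
open import Data.Unit using (tt)
open import Data.Vec using (Vec; []; _∷_; lookup; allFin; _[_]≔_)
open import Data.Vec.Properties
  using (lookup-allFin; lookup∘update; lookup∘update′; []≔-idempotent; []≔-commutes; []≔-lookup)
open import Data.Vec.Relation.Binary.Pointwise.Extensional using (ext; Pointwise-≡⇒≡)
open import Data.Vec.Functional using (updateAt)
open import Data.Vec.Functional.Properties using (updateAt-updates; updateAt-minimal)
open import Function using (id; const; _∘_)
open import Function.Bundles using (_⇔_; mk⇔; Equivalence)
open import Relation.Nullary using (¬_; Dec; yes; no)
open import Relation.Nullary.Decidable using (⌊_⌋; toWitness; fromWitness; dec-false; isYes≗does)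
open import Relation.Binary.PropositionalEquality
open import Relation.Binary.Definitions using (DecidableEquality)

-- Finite cardinalities

module _ {A B : Set} {P : A → Set} {Q : B → Set} {k : ℕ} where

  hasCard-transport : (φ : A → B) (ψ : B → A) →
    (∀ a → P a → Q (φ a)) → (∀ b → Q b → P (ψ b)) →
    (∀ a → P a → ψ (φ a) ≡ a) → (∀ b → Q b → φ (ψ b) ≡ b) →
    HasCard P k → HasCard Q k
  hasCard-transport φ ψ P⇒Q Q⇒P ψφ φψ (f , fP , f-inj , f-onto) =
    φ ∘ f , (λ i → P⇒Q _ (fP i)) , φf-inj , φf-onto
    where
    φf-inj : ∀ i j → φ (f i) ≡ φ (f j) → i ≡ j
    φf-inj i j e = f-inj i j (begin
      f i          ≡⟨ ψφ _ (fP i) ⟨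
      ψ (φ (f i))  ≡⟨ cong ψ e ⟩
      ψ (φ (f j))  ≡⟨ ψφ _ (fP j) ⟩
      f j          ∎)
      where open ≡-Reasoning
    φf-onto : ∀ b → Q b → ∃ λ i → φ (f i) ≡ b
    φf-onto b q with f-onto (ψ b) (Q⇒P b q)
    ... | i , fi≡ψb = i , trans (cong φ fi≡ψb) (φψ b q)

module _ {A : Set} {P Q : A → Set} {k : ℕ} where

  hasCard-⇔ : (∀ a → P a ⇔ Q a) → HasCard P k → HasCard Q k
  hasCard-⇔ P⇔Q =
    hasCard-transport id id (λ a → Equivalence.to (P⇔Q a)) (λ a → Equivalence.from (P⇔Q a))
      (λ _ _ → refl) (λ _ _ → refl)

module _ {A : Set} {P : A → Set} where

  hasCard-∅ : (∀ a → ¬ P a) → HasCard P 0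
  hasCard-∅ ¬P = (λ ()) , (λ ()) , (λ ()) , λ a p → ⊥-elim (¬P a p)

  hasCard-0⇒∅ : HasCard P 0 → ∀ {a} → ¬ P a
  hasCard-0⇒∅ (_ , _ , _ , f-onto) p with f-onto _ p
  ... | () , _

  hasCard-suc⇒∃ : ∀ {k} → HasCard P (suc k) → ∃ P
  hasCard-suc⇒∃ (f , fP , _) = f zero , fP zero

  hasCard-singleton : ∀ {a} → P a → (∀ b → P b → a ≡ b) → HasCard P 1
  hasCard-singleton {a} pa unique =
    (λ _ → a) , (λ _ → pa) , (λ { zero zero _ → refl }) , λ b pb → zero , unique b pb

  hasCard-split : ∀ {D : A → Set} {k₁ k₂} → (∀ a → Dec (D a)) →
    HasCard (λ a → P a × D a) k₁ → HasCard (λ a → P a × ¬ D a) k₂ → HasCard P (k₁ + k₂)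
  hasCard-split {D} {k₁} {k₂} D? (f₁ , f₁P , f₁-inj , f₁-onto) (f₂ , f₂P , f₂-inj , f₂-onto) =
    g ∘ splitAt k₁ , (λ i → gP (splitAt k₁ i)) , g∘splitAt-inj , g∘splitAt-onto
    where
    g : Fin k₁ ⊎ Fin k₂ → A
    g (inj₁ i) = f₁ i
    g (inj₂ j) = f₂ j
    gP : ∀ s → P (g s)
    gP (inj₁ i) = proj₁ (f₁P i)
    gP (inj₂ j) = proj₁ (f₂P j)
    g∘splitAt-inj : ∀ i j → g (splitAt k₁ i) ≡ g (splitAt k₁ j) → i ≡ j
    g∘splitAt-inj i j e with splitAt k₁ i in eqi | splitAt k₁ j in eqj
    ... | inj₁ x | inj₁ y =
      trans (sym (splitAt⁻¹-↑ˡ eqi)) (trans (cong (_↑ˡ k₂) (f₁-inj x y e)) (splitAt⁻¹-↑ˡ eqj))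
    ... | inj₂ x | inj₂ y =
      trans (sym (splitAt⁻¹-↑ʳ eqi)) (trans (cong (k₁ ↑ʳ_) (f₂-inj x y e)) (splitAt⁻¹-↑ʳ eqj))
    ... | inj₁ x | inj₂ y = ⊥-elim (proj₂ (f₂P y) (subst D e (proj₂ (f₁P x))))
    ... | inj₂ x | inj₁ y = ⊥-elim (proj₂ (f₂P x) (subst D (sym e) (proj₂ (f₁P y))))
    g∘splitAt-onto : ∀ a → P a → ∃ λ i → g (splitAt k₁ i) ≡ a
    g∘splitAt-onto a pa with D? a
    ... | yes d = let (i , e) = f₁-onto a (pa , d) in
      i ↑ˡ k₂ , trans (cong g (splitAt-↑ˡ k₁ i k₂)) e
    ... | no ¬d = let (j , e) = f₂-onto a (pa , ¬d) in
      k₁ ↑ʳ j , trans (cong g (splitAt-↑ʳ k₁ k₂ j)) e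

  hasCard-Σ : ∀ {B : Set} {Q : A → B → Set} {m k} →
    HasCard P m → (∀ a → P a → HasCard (Q a) k) →
    HasCard {A × B} (λ (a , b) → P a × Q a b) (m * k)
  hasCard-Σ {B} {Q} {m} {k} (f , fP , f-inj , f-onto) fibre =
    g ∘ remQuot k , (λ x → gPQ (remQuot k x)) , g∘remQuot-inj , g∘remQuot-onto
    where
    h : Fin m → Fin k → B
    h i = proj₁ (fibre (f i) (fP i))
    hQ : ∀ i j → Q (f i) (h i j)
    hQ i = proj₁ (proj₂ (fibre (f i) (fP i)))
    h-inj : ∀ i j j′ → h i j ≡ h i j′ → j ≡ j′
    h-inj i = proj₁ (proj₂ (proj₂ (fibre (f i) (fP i))))
    h-onto : ∀ i b → Q (f i) b → ∃ λ j → h i j ≡ b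
    h-onto i = proj₂ (proj₂ (proj₂ (fibre (f i) (fP i))))
    g : Fin m × Fin k → A × B
    g (i , j) = f i , h i j
    gPQ : ∀ ij → P (proj₁ (g ij)) × Q (proj₁ (g ij)) (proj₂ (g ij))
    gPQ (i , j) = fP i , hQ i j
    g-inj : ∀ s t → g s ≡ g t → s ≡ t
    g-inj (i , j) (i′ , j′) e with f-inj i i′ (cong proj₁ e)
    ... | refl = cong (i ,_) (h-inj i j j′ (cong proj₂ e))
    g∘remQuot-inj : ∀ x y → g (remQuot k x) ≡ g (remQuot k y) → x ≡ y
    g∘remQuot-inj x y e = begin
      x                                ≡⟨ combine-remQuot {m} k x ⟨
      uncurry combine (remQuot {m} k x) ≡⟨ cong (uncurry combine) (g-inj _ _ e) ⟩
      uncurry combine (remQuot {m} k y) ≡⟨ combine-remQuot {m} k y ⟩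
      y                                ∎
      where open ≡-Reasoning
    g∘remQuot-onto : ∀ ab → P (proj₁ ab) × Q (proj₁ ab) (proj₂ ab) → ∃ λ x → g (remQuot k x) ≡ ab
    g∘remQuot-onto (a , b) (pa , qb) with f-onto a pa
    ... | i , refl = let (j , e) = h-onto i b qb in
      combine i j , trans (cong g (remQuot-combine i j)) (cong (f i ,_) e)

hasCard-Vec : ∀ {R : Set} m (P : Fin m → R → Set) (k : Fin m → ℕ) →
  (∀ v → HasCard (P v) (k v)) → HasCard {Vec R m} (λ t → ∀ v → P v (lookup t v)) (prodFin k)
hasCard-Vec zero P k _ =
  hasCard-singleton (λ ()) λ { [] _ → refl }
hasCard-Vec {R} (suc m) P k card =
  hasCard-transport fromHeadTail toHeadTail fromHeadTail-valid toHeadTail-valid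
    (λ _ _ → refl) fromHeadTail∘toHeadTail
    (hasCard-Σ (card zero) λ _ _ → hasCard-Vec m (P ∘ suc) (k ∘ suc) (card ∘ suc))
  where
  ValidHeadTail : R × Vec R m → Set
  ValidHeadTail (x , t) = P zero x × (∀ v → P (suc v) (lookup t v))
  Valid : Vec R (suc m) → Set
  Valid t = ∀ v → P v (lookup t v)
  fromHeadTail : R × Vec R m → Vec R (suc m)
  fromHeadTail (x , t) = x ∷ t
  toHeadTail : Vec R (suc m) → R × Vec R m
  toHeadTail (x ∷ t) = x , t
  fromHeadTail-valid : ∀ xt → ValidHeadTail xt → Valid (fromHeadTail xt)
  fromHeadTail-valid _ (p , _) zero = p
  fromHeadTail-valid _ (_ , q) (suc v) = q v
  toHeadTail-valid : ∀ t → Valid t → ValidHeadTail (toHeadTail t)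
  toHeadTail-valid (x ∷ t) h = h zero , h ∘ suc
  fromHeadTail∘toHeadTail : ∀ t → Valid t → fromHeadTail (toHeadTail t) ≡ t
  fromHeadTail∘toHeadTail (x ∷ t) _ = refl

hasCard-countFin : ∀ {n} (p : Fin n → Bool) → HasCard (T ∘ p) (countFin p)
hasCard-countFin {zero} p = hasCard-∅ λ ()
hasCard-countFin {suc n} p with p zero in p0 | hasCard-countFin (p ∘ suc)
... | true | f , fP , f-inj , f-onto = g , gP , g-inj , g-onto
  where
  g : Fin (suc (countFin (p ∘ suc))) → Fin (suc n)
  g zero = zero
  g (suc i) = suc (f i)
  gP : ∀ i → T (p (g i))
  gP zero = subst T (sym p0) tt
  gP (suc i) = fP i
  g-inj : ∀ i j → g i ≡ g j → i ≡ j
  g-inj zero zero _ = refl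
  g-inj (suc i) (suc j) e = cong suc (f-inj i j (suc-injective e))
  g-onto : ∀ w → T (p w) → ∃ λ i → g i ≡ w
  g-onto zero _ = zero , refl
  g-onto (suc w) pw = let (i , e) = f-onto w pw in suc i , cong suc e
... | false | f , fP , f-inj , f-onto = suc ∘ f , fP , (λ i j e → f-inj i j (suc-injective e)) , g-onto
  where
  g-onto : ∀ w → T (p w) → ∃ λ i → suc (f i) ≡ w
  g-onto zero pw = ⊥-elim (subst T p0 pw)
  g-onto (suc w) pw = let (i , e) = f-onto w pw in i , cong suc e

countFin-cong : ∀ {n} {p q : Fin n → Bool} → (∀ w → p w ≡ q w) → countFin p ≡ countFin q
countFin-cong {zero} _ = refl
countFin-cong {suc n} {p} {q} p≗q with p zero | q zero | p≗q zero
... | true  | .true  | refl = cong suc (countFin-cong (p≗q ∘ suc))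
... | false | .false | refl = countFin-cong (p≗q ∘ suc)

countFin-remove : ∀ {n} {p q : Fin n → Bool} (w₀ : Fin n) → T (p w₀) → ¬ T (q w₀) →
  (∀ w → w ≢ w₀ → p w ≡ q w) → countFin p ≡ suc (countFin q)
countFin-remove {suc n} {p} {q} zero pw₀ ¬qw₀ same with p zero | q zero
... | true | false = cong suc (countFin-cong λ w → same (suc w) λ ())
... | true | true = ⊥-elim (¬qw₀ tt)
countFin-remove {suc n} {p} {q} (suc w₀) pw₀ ¬qw₀ same with p zero | q zero | same zero (λ ())
... | true  | .true  | refl = cong suc (countFin-remove w₀ pw₀ ¬qw₀ λ w w≢w₀ → same (suc w) (w≢w₀ ∘ suc-injective))
... | false | .false | refl = countFin-remove w₀ pw₀ ¬qw₀ λ w w≢w₀ → same (suc w) (w≢w₀ ∘ suc-injective)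

countFin-split : ∀ {n} (p q : Fin n → Bool) →
  countFin p ≡ countFin (λ w → p w ∧ q w) + countFin (λ w → p w ∧ not (q w))
countFin-split {zero} p q = refl
countFin-split {suc n} p q with p zero | q zero
... | false | _     = countFin-split (p ∘ suc) (q ∘ suc)
... | true  | true  = cong suc (countFin-split (p ∘ suc) (q ∘ suc))
... | true  | false = trans (cong suc (countFin-split (p ∘ suc) (q ∘ suc))) (sym (+-suc _ _))

countFin-xor : ∀ {n} (p q : Fin n → Bool) →
  countFin (λ w → p w xor q w) ≡ countFin (λ w → p w ∧ not (q w)) + countFin (λ w → q w ∧ not (p w))
countFin-xor p q = trans (countFin-split (λ w → p w xor q w) p)
  (cong₂ _+_ (countFin-cong λ w → xor-∧-left (p w) (q w)) (countFin-cong λ w → xor-∧-not-left (p w) (q w)))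
  where
  xor-∧-left : ∀ x y → (x xor y) ∧ x ≡ x ∧ not y
  xor-∧-left true  true  = refl
  xor-∧-left true  false = refl
  xor-∧-left false true  = refl
  xor-∧-left false false = refl
  xor-∧-not-left : ∀ x y → (x xor y) ∧ not x ≡ y ∧ not x
  xor-∧-not-left true  true  = refl
  xor-∧-not-left true  false = refl
  xor-∧-not-left false true  = refl
  xor-∧-not-left false false = refl

-- Involutive rows with at most one fixpoint

-- At a vertex v, a pair {v,w} is labelled nothing if it is not in ∇_v,
-- and just b if it is in ∇_v, where b records whether it is an edge of X.
Label : ℕ → Set
Label n = Fin n → Maybe Bool

nothing≢just : ∀ {A : Set} {x : A} → nothing ≢ just x
nothing≢just ()

_≟ₘ_ : DecidableEquality (Maybe Bool)
_≟ₘ_ = ≡-dec _≟ᵇ_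

#labels : ∀ {n} → Label n → Bool → ℕ
#labels L β = countFin (λ w → ⌊ L w ≟ₘ just β ⌋)

erase : ∀ {n} → Label n → Fin n → Label n
erase L w₀ = updateAt L w₀ (const nothing)

module _ {n} (L : Label n) where

  hasCard-labels : ∀ β → HasCard (λ w → L w ≡ just β) (#labels L β)
  hasCard-labels β = hasCard-⇔ (λ w → mk⇔ (toWitness {a? = L w ≟ₘ just β}) fromWitness) (hasCard-countFin _)

  #labels≡0⇒ : ∀ {β w} → #labels L β ≡ 0 → L w ≢ just β
  #labels≡0⇒ {β} #≡0 = hasCard-0⇒∅ (subst (HasCard _) #≡0 (hasCard-labels β))

  #labels≡suc⇒ : ∀ {β k} → #labels L β ≡ suc k → ∃ λ w → L w ≡ just β
  #labels≡suc⇒ {β} #≡suc = hasCard-suc⇒∃ (subst (HasCard _) #≡suc (hasCard-labels β))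

  ≢-by-label : ∀ {w w′ β} → L w ≡ just β → L w′ ≡ just (not β) → w ≢ w′
  ≢-by-label Lw Lw′ refl = not-¬ refl (just-injective (trans (sym Lw) Lw′))

  erase-erased : ∀ w₀ → erase L w₀ w₀ ≡ nothing
  erase-erased w₀ = updateAt-updates w₀ L

  erase-other : ∀ {w₀ w} → w ≢ w₀ → erase L w₀ w ≡ L w
  erase-other {w₀} {w} w≢w₀ = updateAt-minimal w w₀ L w≢w₀

  erase-opposite : ∀ {w₀ w₁ β} → L w₀ ≡ just β → L w₁ ≡ just (not β) → erase L w₀ w₁ ≡ just (not β)
  erase-opposite Lw₀ Lw₁ = trans (erase-other (≢-by-label Lw₀ Lw₁ ∘ sym)) Lw₁

  erase-just : ∀ {w₀ w b} → erase L w₀ w ≡ just b → w ≢ w₀ × L w ≡ just b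
  erase-just {w₀} {w} e with w ≟ w₀
  ... | yes refl = ⊥-elim (nothing≢just (trans (sym (erase-erased w)) e))
  ... | no w≢w₀ = w≢w₀ , trans (sym (erase-other w≢w₀)) e

  erase-nothing : ∀ {w₀ w} → erase L w₀ w ≡ nothing → w ≡ w₀ ⊎ L w ≡ nothing
  erase-nothing {w₀} {w} e with w ≟ w₀
  ... | yes w≡w₀ = inj₁ w≡w₀
  ... | no w≢w₀ = inj₂ (trans (sym (erase-other w≢w₀)) e)

  #labels-erase : ∀ {w₀ β k} → L w₀ ≡ just β → #labels L β ≡ suc k → #labels (erase L w₀) β ≡ k
  #labels-erase {w₀} {β} Lw₀ #≡suc = cong pred (trans (sym (countFin-remove w₀ (fromWitness Lw₀) erased same)) #≡suc)
    where
    erased : ¬ T ⌊ erase L w₀ w₀ ≟ₘ just β ⌋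
    erased t with () ← trans (sym (erase-erased w₀)) (toWitness t)
    same : ∀ w → w ≢ w₀ → ⌊ L w ≟ₘ just β ⌋ ≡ ⌊ erase L w₀ w ≟ₘ just β ⌋
    same w w≢w₀ = cong (λ l → ⌊ l ≟ₘ just β ⌋) (sym (erase-other w≢w₀))

  #labels-erase-other : ∀ {w₀ β γ} → L w₀ ≡ just β → γ ≢ β → #labels (erase L w₀) γ ≡ #labels L γ
  #labels-erase-other {w₀} {β} {γ} Lw₀ γ≢β = countFin-cong same
    where
    same : ∀ w → ⌊ erase L w₀ w ≟ₘ just γ ⌋ ≡ ⌊ L w ≟ₘ just γ ⌋
    same w with w ≟ w₀
    ... | yes refl = trans (refuted _ λ e → nothing≢just (trans (sym (erase-erased w)) e))
                           (sym (refuted _ λ e → γ≢β (just-injective (trans (sym e) Lw₀))))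
      where
      refuted : ∀ l → l ≢ just γ → ⌊ l ≟ₘ just γ ⌋ ≡ false
      refuted l l≢γ = trans (isYes≗does (l ≟ₘ just γ)) (dec-false (l ≟ₘ just γ) l≢γ)
    ... | no w≢w₀ = cong (λ l → ⌊ l ≟ₘ just γ ⌋) (erase-other w≢w₀)

Row : ℕ → Set
Row n = Vec (Fin n) n

Partnered : ∀ {n} → Label n → Row n → Fin n → Bool → Set
Partnered L r w b = L (lookup r w) ≡ just (not b) × lookup r (lookup r w) ≡ w

SoleFixpoint : ∀ {n} → Label n → Row n → Fin n → Set
SoleFixpoint L r w = lookup r w ≡ w × (∀ w′ {b′} → L w′ ≡ just b′ → lookup r w′ ≡ w′ → w′ ≡ w)

-- r encodes s(v, ·) at one vertex v: lookup r w is the other end of s(v, {v,w}).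
-- A fixpoint on a labelled pair is permitted only if mayFix.
record ValidRow {n} (L : Label n) (mayFix : Bool) (r : Row n) : Set where
  constructor validRow
  field
    fixes-unlabelled : ∀ w → L w ≡ nothing → lookup r w ≡ w
    on-labelled      : ∀ w {b} → L w ≡ just b → (T mayFix × SoleFixpoint L r w) ⊎ Partnered L r w b
open ValidRow

module _ {n} {r : Row n} where

  partnered⇒moved : ∀ {L : Label n} {w b} → L w ≡ just b → Partnered L r w b → lookup r w ≢ w
  partnered⇒moved {L} Lw (Lrw , _) rw≡w =
    not-¬ refl (just-injective (trans (sym Lw) (trans (cong L (sym rw≡w)) Lrw)))

  validRow-false⇒moved : ∀ {L : Label n} {w b} → L w ≡ just b → ValidRow L false r → lookup r w ≢ w
  validRow-false⇒moved {L} {w} Lw V with on-labelled V w Lw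
  ... | inj₂ partnered = partnered⇒moved {L = L} Lw partnered

  moved⇒partnered : ∀ {L : Label n} {mayFix w b} → L w ≡ just b → ValidRow L mayFix r →
    lookup r w ≢ w → Partnered L r w b
  moved⇒partnered {w = w} Lw V moved with on-labelled V w Lw
  ... | inj₁ (_ , fixed , _) = ⊥-elim (moved fixed)
  ... | inj₂ partnered = partnered

  -- Fixing a labelled w₀ uses up the one permitted fixpoint.
  validRow-erase⇔fixed : ∀ {L : Label n} {w₀ β} → L w₀ ≡ just β →
    ValidRow (erase L w₀) false r ⇔ (ValidRow L true r × lookup r w₀ ≡ w₀)
  validRow-erase⇔fixed {L} {w₀} Lw₀ = mk⇔ to from
    where
    to : ValidRow (erase L w₀) false r → ValidRow L true r × lookup r w₀ ≡ w₀
    to V′ = validRow unlabelled labelled , fixed₀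
      where
      fixed₀ : lookup r w₀ ≡ w₀
      fixed₀ = fixes-unlabelled V′ w₀ (erase-erased L w₀)
      unlabelled : ∀ w → L w ≡ nothing → lookup r w ≡ w
      unlabelled w Lw = fixes-unlabelled V′ w (trans (erase-other L w≢w₀) Lw)
        where
        w≢w₀ : w ≢ w₀
        w≢w₀ refl with () ← trans (sym Lw) Lw₀
      labelled : ∀ w {b} → L w ≡ just b → (T true × SoleFixpoint L r w) ⊎ Partnered L r w b
      labelled w Lw with w ≟ w₀
      ... | yes refl = inj₁ (tt , fixed₀ , sole)
        where
        sole : ∀ w′ {b′} → L w′ ≡ just b′ → lookup r w′ ≡ w′ → w′ ≡ w
        sole w′ Lw′ fixed with w′ ≟ w
        ... | yes w′≡w = w′≡w
        ... | no w′≢w = ⊥-elim (validRow-false⇒moved (trans (erase-other L w′≢w) Lw′) V′ fixed)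
      ... | no w≢w₀ with on-labelled V′ w (trans (erase-other L w≢w₀) Lw)
      ...   | inj₂ (Lrw , rrw) = inj₂ (proj₂ (erase-just L Lrw) , rrw)
    from : ValidRow L true r × lookup r w₀ ≡ w₀ → ValidRow (erase L w₀) false r
    from (V , fixed₀) = validRow unlabelled labelled
      where
      unlabelled : ∀ w → erase L w₀ w ≡ nothing → lookup r w ≡ w
      unlabelled w e with erase-nothing L e
      ... | inj₁ refl = fixed₀
      ... | inj₂ Lw = fixes-unlabelled V w Lw
      labelled : ∀ w {b} → erase L w₀ w ≡ just b →
        (T false × SoleFixpoint (erase L w₀) r w) ⊎ Partnered (erase L w₀) r w b
      labelled w e with erase-just L e
      ... | w≢w₀ , Lw with on-labelled V w Lw
      ...   | inj₁ (_ , _ , sole) = ⊥-elim (w≢w₀ (sym (sole w₀ Lw₀ fixed₀)))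
      ...   | inj₂ (Lrw , rrw) = inj₂ (trans (erase-other L rw≢w₀) Lrw , rrw)
        where
        rw≢w₀ : lookup r w ≢ w₀
        rw≢w₀ rw≡w₀ = w≢w₀ (trans (sym rrw) (trans (cong (lookup r) rw≡w₀) fixed₀))

module _ {A : Set} {n} {a b : Fin n} (xs : Vec A n) (x y : A) where

  lookup-update²-first : a ≢ b → lookup ((xs [ a ]≔ x) [ b ]≔ y) a ≡ x
  lookup-update²-first a≢b = trans (lookup∘update′ a≢b (xs [ a ]≔ x) y) (lookup∘update a xs x)

  lookup-update²-other : ∀ {w} → w ≢ a → w ≢ b → lookup ((xs [ a ]≔ x) [ b ]≔ y) w ≡ lookup xs w
  lookup-update²-other w≢a w≢b = trans (lookup∘update′ w≢b (xs [ a ]≔ x) y) (lookup∘update′ w≢a xs x)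

update²-restore : ∀ {A : Set} {n} {a b : Fin n} (xs : Vec A n) {x y x′ y′ : A} → a ≢ b →
  lookup xs a ≡ x → lookup xs b ≡ y → (((xs [ a ]≔ x′) [ b ]≔ y′) [ a ]≔ x) [ b ]≔ y ≡ xs
update²-restore {a = a} {b} xs {x} {y} {x′} {y′} a≢b xs[a] xs[b] = begin
  (((xs [ a ]≔ x′) [ b ]≔ y′) [ a ]≔ x) [ b ]≔ y  ≡⟨ cong (_[ b ]≔ y) ([]≔-commutes (xs [ a ]≔ x′) b a (a≢b ∘ sym)) ⟩
  (((xs [ a ]≔ x′) [ a ]≔ x) [ b ]≔ y′) [ b ]≔ y  ≡⟨ []≔-idempotent ((xs [ a ]≔ x′) [ a ]≔ x) b ⟩
  ((xs [ a ]≔ x′) [ a ]≔ x) [ b ]≔ y              ≡⟨ cong (_[ b ]≔ y) ([]≔-idempotent xs a) ⟩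
  (xs [ a ]≔ x) [ b ]≔ y                          ≡⟨ cong₂ (λ u v → (xs [ a ]≔ u) [ b ]≔ v) (sym xs[a]) (sym xs[b]) ⟩
  (xs [ a ]≔ lookup xs a) [ b ]≔ lookup xs b      ≡⟨ cong (λ zs → zs [ b ]≔ lookup xs b) ([]≔-lookup xs a) ⟩
  xs [ b ]≔ lookup xs b                           ≡⟨ []≔-lookup xs b ⟩
  xs                                              ∎
  where open ≡-Reasoning

pairUp : ∀ {n} → Fin n → Fin n → Row n → Row n
pairUp w₀ w₁ g = (g [ w₀ ]≔ w₁) [ w₁ ]≔ w₀

unpair : ∀ {n} → Fin n → Fin n → Row n → Row n
unpair w₀ w₁ r = (r [ w₀ ]≔ w₀) [ w₁ ]≔ w₁

module _ {n} {L : Label n} {w₀ : Fin n} {β : Bool} (Lw₀ : L w₀ ≡ just β) where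

  module _ {w₁ : Fin n} (Lw₁ : L w₁ ≡ just (not β)) where

    private
      L₂ : Label n
      L₂ = erase (erase L w₀) w₁

      w₀≢w₁ : w₀ ≢ w₁
      w₀≢w₁ = ≢-by-label L Lw₀ Lw₁

      L₂-other : ∀ {w} → w ≢ w₀ → w ≢ w₁ → L₂ w ≡ L w
      L₂-other w≢w₀ w≢w₁ = trans (erase-other _ w≢w₁) (erase-other L w≢w₀)

      L₂-just : ∀ {w b} → L₂ w ≡ just b → w ≢ w₀ × w ≢ w₁ × L w ≡ just b
      L₂-just e = let (w≢w₁ , e′) = erase-just _ e ; (w≢w₀ , Lw) = erase-just L e′ in w≢w₀ , w≢w₁ , Lw

      L₂-w₀ : L₂ w₀ ≡ nothing
      L₂-w₀ = trans (erase-other _ w₀≢w₁) (erase-erased L w₀)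

      L₂-w₁ : L₂ w₁ ≡ nothing
      L₂-w₁ = erase-erased _ w₁

    validRow-pairUp : ∀ {mayFix g} → ValidRow L₂ mayFix g → ValidRow L mayFix (pairUp w₀ w₁ g)
    validRow-pairUp {mayFix} {g} G = validRow unlabelled labelled
      where
      r = pairUp w₀ w₁ g
      r-w₀ : lookup r w₀ ≡ w₁
      r-w₀ = lookup-update²-first g w₁ w₀ w₀≢w₁
      r-w₁ : lookup r w₁ ≡ w₀
      r-w₁ = lookup∘update w₁ (g [ w₀ ]≔ w₁) w₀
      r-other : ∀ {w} → w ≢ w₀ → w ≢ w₁ → lookup r w ≡ lookup g w
      r-other = lookup-update²-other g w₁ w₀
      unlabelled : ∀ w → L w ≡ nothing → lookup r w ≡ w
      unlabelled w Lw = trans (r-other w≢w₀ w≢w₁) (fixes-unlabelled G w (trans (L₂-other w≢w₀ w≢w₁) Lw))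
        where
        w≢w₀ : w ≢ w₀
        w≢w₀ refl with () ← trans (sym Lw₀) Lw
        w≢w₁ : w ≢ w₁
        w≢w₁ refl with () ← trans (sym Lw₁) Lw
      labelled : ∀ w {b} → L w ≡ just b → (T mayFix × SoleFixpoint L r w) ⊎ Partnered L r w b
      labelled w Lw with w ≟ w₀ | w ≟ w₁
      ... | yes refl | _ with refl ← just-injective (trans (sym Lw₀) Lw) =
        inj₂ (trans (cong L r-w₀) Lw₁ , trans (cong (lookup r) r-w₀) r-w₁)
      ... | no _ | yes refl with refl ← just-injective (trans (sym Lw₁) Lw) =
        inj₂ (trans (cong L r-w₁) (trans Lw₀ (cong just (sym (not-involutive β)))) , trans (cong (lookup r) r-w₁) r-w₀)
      ... | no w≢w₀ | no w≢w₁ with on-labelled G w (trans (L₂-other w≢w₀ w≢w₁) Lw)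
      ...   | inj₁ (may , gw≡w , sole) = inj₁ (may , trans (r-other w≢w₀ w≢w₁) gw≡w , sole′)
        where
        sole′ : ∀ w′ {b′} → L w′ ≡ just b′ → lookup r w′ ≡ w′ → w′ ≡ w
        sole′ w′ Lw′ fixed with w′ ≟ w₀ | w′ ≟ w₁
        ... | yes refl | _ = ⊥-elim (w₀≢w₁ (trans (sym fixed) r-w₀))
        ... | no _ | yes refl = ⊥-elim (w₀≢w₁ (trans (sym r-w₁) fixed))
        ... | no w′≢w₀ | no w′≢w₁ =
          sole w′ (trans (L₂-other w′≢w₀ w′≢w₁) Lw′) (trans (sym (r-other w′≢w₀ w′≢w₁)) fixed)
      ...   | inj₂ (L₂gw , ggw) = inj₂ (Lrw , rrw)
        where
        gw-far = L₂-just L₂gw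
        rw≡gw : lookup r w ≡ lookup g w
        rw≡gw = r-other w≢w₀ w≢w₁
        Lrw : L (lookup r w) ≡ just (not _)
        Lrw = trans (cong L rw≡gw) (proj₂ (proj₂ gw-far))
        rrw : lookup r (lookup r w) ≡ w
        rrw = trans (cong (lookup r) rw≡gw) (trans (r-other (proj₁ gw-far) (proj₁ (proj₂ gw-far))) ggw)

    validRow-unpair : ∀ {mayFix r} → ValidRow L mayFix r → lookup r w₀ ≡ w₁ → lookup r w₁ ≡ w₀ →
      ValidRow L₂ mayFix (unpair w₀ w₁ r)
    validRow-unpair {mayFix} {r} V r-w₀ r-w₁ = validRow unlabelled labelled
      where
      g = unpair w₀ w₁ r
      g-other : ∀ {w} → w ≢ w₀ → w ≢ w₁ → lookup g w ≡ lookup r w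
      g-other = lookup-update²-other r w₀ w₁
      unlabelled : ∀ w → L₂ w ≡ nothing → lookup g w ≡ w
      unlabelled w L₂w with w ≟ w₀ | w ≟ w₁
      ... | yes refl | _ = lookup-update²-first r w₀ w₁ w₀≢w₁
      ... | no _ | yes refl = lookup∘update w₁ (r [ w₀ ]≔ w₀) w₁
      ... | no w≢w₀ | no w≢w₁ = trans (g-other w≢w₀ w≢w₁) (fixes-unlabelled V w (trans (sym (L₂-other w≢w₀ w≢w₁)) L₂w))
      labelled : ∀ w {b} → L₂ w ≡ just b → (T mayFix × SoleFixpoint L₂ g w) ⊎ Partnered L₂ g w b
      labelled w L₂w with L₂-just L₂w
      ... | w≢w₀ , w≢w₁ , Lw with on-labelled V w Lw
      ...   | inj₁ (may , rw≡w , sole) = inj₁ (may , trans (g-other w≢w₀ w≢w₁) rw≡w , sole′)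
        where
        sole′ : ∀ w′ {b′} → L₂ w′ ≡ just b′ → lookup g w′ ≡ w′ → w′ ≡ w
        sole′ w′ L₂w′ fixed with L₂-just L₂w′
        ... | w′≢w₀ , w′≢w₁ , Lw′ = sole w′ Lw′ (trans (sym (g-other w′≢w₀ w′≢w₁)) fixed)
      ...   | inj₂ (Lrw , rrw) = inj₂ (trans (cong L₂ gw≡rw) (trans (L₂-other rw≢w₀ rw≢w₁) Lrw) ,
                                       trans (cong (lookup g) gw≡rw) (trans (g-other rw≢w₀ rw≢w₁) rrw))
        where
        gw≡rw : lookup g w ≡ lookup r w
        gw≡rw = g-other w≢w₀ w≢w₁
        rw≢w₀ : lookup r w ≢ w₀
        rw≢w₀ rw≡w₀ = w≢w₁ (trans (sym rrw) (trans (cong (lookup r) rw≡w₀) r-w₀))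
        rw≢w₁ : lookup r w ≢ w₁
        rw≢w₁ rw≡w₁ = w≢w₀ (trans (sym rrw) (trans (cong (lookup r) rw≡w₁) r-w₁))
    pairUp-w₀ : ∀ g → lookup (pairUp w₀ w₁ g) w₀ ≡ w₁
    pairUp-w₀ g = lookup-update²-first g w₁ w₀ w₀≢w₁

    unpair∘pairUp : ∀ {mayFix g} → ValidRow L₂ mayFix g → unpair w₀ w₁ (pairUp w₀ w₁ g) ≡ g
    unpair∘pairUp {g = g} G = update²-restore g w₀≢w₁ (fixes-unlabelled G w₀ L₂-w₀) (fixes-unlabelled G w₁ L₂-w₁)

    pairUp∘unpair : ∀ {r} → lookup r w₀ ≡ w₁ → lookup r w₁ ≡ w₀ → pairUp w₀ w₁ (unpair w₀ w₁ r) ≡ r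
    pairUp∘unpair {r} = update²-restore r w₀≢w₁

  hasCard-moved : ∀ {mayFix c} →
    (∀ w₁ → L w₁ ≡ just (not β) → HasCard (ValidRow (erase (erase L w₀) w₁) mayFix) c) →
    HasCard (λ r → ValidRow L mayFix r × lookup r w₀ ≢ w₀) (#labels L (not β) * c)
  hasCard-moved {mayFix} fibre =
    hasCard-transport join split join-valid split-valid split∘join join∘split
      (hasCard-Σ (hasCard-labels L (not β)) fibre)
    where
    Fibre : Fin n × Row n → Set
    Fibre (w₁ , g) = L w₁ ≡ just (not β) × ValidRow (erase (erase L w₀) w₁) mayFix g
    Moved : Row n → Set
    Moved r = ValidRow L mayFix r × lookup r w₀ ≢ w₀
    join : Fin n × Row n → Row n
    join (w₁ , g) = pairUp w₀ w₁ g
    split : Row n → Fin n × Row n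
    split r = lookup r w₀ , unpair w₀ (lookup r w₀) r
    join-valid : ∀ wg → Fibre wg → Moved (join wg)
    join-valid (w₁ , g) (Lw₁ , G) =
      validRow-pairUp Lw₁ G , λ fixed → ≢-by-label L Lw₀ Lw₁ (trans (sym fixed) (pairUp-w₀ Lw₁ g))
    split-valid : ∀ r → Moved r → Fibre (split r)
    split-valid r (V , moved) =
      let (Lw₁ , r-w₁) = moved⇒partnered Lw₀ V moved in Lw₁ , validRow-unpair Lw₁ V refl r-w₁
    split∘join : ∀ wg → Fibre wg → split (join wg) ≡ wg
    split∘join (w₁ , g) (Lw₁ , G) =
      trans (cong (λ x → x , unpair w₀ x (pairUp w₀ w₁ g)) (pairUp-w₀ Lw₁ g)) (cong (w₁ ,_) (unpair∘pairUp Lw₁ G))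
    join∘split : ∀ r → Moved r → join (split r) ≡ r
    join∘split r (V , moved) =
      let (Lw₁ , r-w₁) = moved⇒partnered Lw₀ V moved in pairUp∘unpair Lw₁ refl r-w₁

  -- Either the labelled w₀ is the fixpoint, or it is paired with one of the oppositely labelled w₁.
  hasCard-validRow-step : ∀ {mayFix f c} →
    HasCard (ValidRow (erase L w₀) false) f →
    (∀ w₁ → L w₁ ≡ just (not β) → HasCard (ValidRow (erase (erase L w₀) w₁) mayFix) c) →
    HasCard (ValidRow L mayFix) ((if mayFix then f else 0) + #labels L (not β) * c)
  hasCard-validRow-step {mayFix} {f} fixedCard fibre =
    hasCard-split (λ r → lookup r w₀ ≟ w₀) (hasCard-fixed mayFix) (hasCard-moved fibre)
    where
    hasCard-fixed : ∀ mayFix → HasCard (λ r → ValidRow L mayFix r × lookup r w₀ ≡ w₀) (if mayFix then f else 0)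
    hasCard-fixed true  = hasCard-⇔ (λ _ → validRow-erase⇔fixed Lw₀) fixedCard
    hasCard-fixed false = hasCard-∅ λ r (V , fixed) → validRow-false⇒moved Lw₀ V fixed

hasCard-validRow-unlabelled : ∀ {n} {L : Label n} {mayFix} → (∀ w → L w ≡ nothing) →
  HasCard (ValidRow L mayFix) 1
hasCard-validRow-unlabelled {n} {L} unlabelled = hasCard-singleton identity-valid identity-unique
  where
  identity-valid : ValidRow L _ (allFin n)
  identity-valid = validRow (λ w _ → lookup-allFin w) λ w Lw → ⊥-elim (nothing≢just (trans (sym (unlabelled w)) Lw))
  identity-unique : ∀ r → ValidRow L _ r → allFin n ≡ r
  identity-unique r V = Pointwise-≡⇒≡ (ext λ w → trans (lookup-allFin w) (sym (fixes-unlabelled V w (unlabelled w))))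

mutual

  hasCard-validRow-balanced : ∀ {n} k mayFix {L : Label n} →
    #labels L true ≡ k → #labels L false ≡ k → HasCard (ValidRow L mayFix) (k !)
  hasCard-validRow-balanced zero mayFix {L} #true #false = hasCard-validRow-unlabelled unlabelled
    where
    unlabelled : ∀ w → L w ≡ nothing
    unlabelled w with L w in Lw
    ... | nothing    = refl
    ... | just true  = ⊥-elim (#labels≡0⇒ L #true Lw)
    ... | just false = ⊥-elim (#labels≡0⇒ L #false Lw)
  hasCard-validRow-balanced (suc k) mayFix {L} #true #false with #labels≡suc⇒ L #true
  ... | w₀ , Lw₀ = subst (HasCard _) (count mayFix) (hasCard-validRow-step Lw₀ erasedCard fibre)
    where
    #true′ : #labels (erase L w₀) true ≡ k
    #true′ = #labels-erase L Lw₀ #true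
    #false′ : #labels (erase L w₀) false ≡ suc k
    #false′ = trans (#labels-erase-other L Lw₀ λ ()) #false
    erasedCard : HasCard (ValidRow (erase L w₀) false) 0
    erasedCard = hasCard-validRow-unbalanced k false false #false′ #true′
    fibre : ∀ w₁ → L w₁ ≡ just false → HasCard (ValidRow (erase (erase L w₀) w₁) mayFix) (k !)
    fibre w₁ Lw₁ = hasCard-validRow-balanced k mayFix
      (trans (#labels-erase-other (erase L w₀) (erase-opposite L Lw₀ Lw₁) λ ()) #true′)
      (#labels-erase (erase L w₀) (erase-opposite L Lw₀ Lw₁) #false′)
    count : ∀ mayFix → (if mayFix then 0 else 0) + #labels L false * k ! ≡ suc k !
    count true  = cong (_* k !) #false
    count false = cong (_* k !) #false

  hasCard-validRow-unbalanced : ∀ {n} k β mayFix {L : Label n} →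
    #labels L β ≡ suc k → #labels L (not β) ≡ k → HasCard (ValidRow L mayFix) (if mayFix then suc k ! else 0)
  hasCard-validRow-unbalanced k β mayFix {L} #β #¬β with #labels≡suc⇒ L #β
  ... | w₀ , Lw₀ = subst (HasCard _) (count mayFix) (hasCard-validRow-step Lw₀ erasedCard (fibre k #β′ #¬β′))
    where
    #β′ : #labels (erase L w₀) β ≡ k
    #β′ = #labels-erase L Lw₀ #β
    #¬β′ : #labels (erase L w₀) (not β) ≡ k
    #¬β′ = trans (#labels-erase-other L Lw₀ (not-¬ refl ∘ sym)) #¬β
    erasedCard : HasCard (ValidRow (erase L w₀) false) (k !)
    erasedCard = hasCard-validRow-balanced-at k β false #β′ #¬β′
    fibre : ∀ k → #labels (erase L w₀) β ≡ k → #labels (erase L w₀) (not β) ≡ k → ∀ w₁ → L w₁ ≡ just (not β) →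
      HasCard (ValidRow (erase (erase L w₀) w₁) mayFix) (if mayFix then k ! else 0)
    fibre zero    _   #¬β′ w₁ Lw₁ = ⊥-elim (#labels≡0⇒ (erase L w₀) #¬β′ (erase-opposite L Lw₀ Lw₁))
    fibre (suc k) #β′ #¬β′ w₁ Lw₁ = hasCard-validRow-unbalanced k β mayFix
      (trans (#labels-erase-other (erase L w₀) (erase-opposite L Lw₀ Lw₁) (not-¬ refl)) #β′)
      (#labels-erase (erase L w₀) (erase-opposite L Lw₀ Lw₁) #¬β′)
    count : ∀ mayFix → (if mayFix then k ! else 0) + #labels L (not β) * (if mayFix then k ! else 0)
                     ≡ (if mayFix then suc k ! else 0)
    count true  = cong (λ m → k ! + m * k !) #¬β
    count false = *-zeroʳ (#labels L (not β))

  hasCard-validRow-balanced-at : ∀ {n} k β mayFix {L : Label n} →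
    #labels L β ≡ k → #labels L (not β) ≡ k → HasCard (ValidRow L mayFix) (k !)
  hasCard-validRow-balanced-at k true  mayFix #true #false = hasCard-validRow-balanced k mayFix #true #false
  hasCard-validRow-balanced-at k false mayFix #false #true = hasCard-validRow-balanced k mayFix #true #false

≤suc-cases : ∀ {a b} → a ≤ suc b → b ≤ suc a → a ≡ b ⊎ a ≡ suc b ⊎ b ≡ suc a
≤suc-cases a≤1+b b≤1+a with m≤n⇒m<n∨m≡n a≤1+b | m≤n⇒m<n∨m≡n b≤1+a
... | inj₂ a≡1+b | _         = inj₂ (inj₁ a≡1+b)
... | inj₁ _     | inj₂ b≡1+a = inj₂ (inj₂ b≡1+a)
... | inj₁ a<1+b | inj₁ b<1+a = inj₁ (≤-antisym (s≤s⁻¹ a<1+b) (s≤s⁻¹ b<1+a))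

⌈1+n+n/2⌉≡1+n : ∀ n → ⌈ suc n + n /2⌉ ≡ suc n
⌈1+n+n/2⌉≡1+n n = cong suc (sym (n≡⌊n+n/2⌋ n))

⌈n+1+n/2⌉≡1+n : ∀ n → ⌈ n + suc n /2⌉ ≡ suc n
⌈n+1+n/2⌉≡1+n n = trans (cong ⌈_/2⌉ (+-suc n n)) (⌈1+n+n/2⌉≡1+n n)

hasCard-validRow : ∀ {n} {L : Label n} {a b} → #labels L true ≡ a → #labels L false ≡ b →
  a ≤ suc b → b ≤ suc a → HasCard (ValidRow L true) (⌈ a + b /2⌉ !)
hasCard-validRow {L = L} {a} {b} #true #false a≤1+b b≤1+a with ≤suc-cases a≤1+b b≤1+a
... | inj₁ refl        = subst (λ m → HasCard (ValidRow L true) (m !)) (n≡⌈n+n/2⌉ a)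
                               (hasCard-validRow-balanced a true #true #false)
... | inj₂ (inj₁ refl) = subst (λ m → HasCard (ValidRow L true) (m !)) (sym (⌈1+n+n/2⌉≡1+n b))
                               (hasCard-validRow-unbalanced b true true #true #false)
... | inj₂ (inj₂ refl) = subst (λ m → HasCard (ValidRow L true) (m !)) (sym (⌈n+1+n/2⌉≡1+n a))
                               (hasCard-validRow-unbalanced a false true #false #true)

-- Rows of the elements of S_{X,Y}

edgeLabel : Bool → Bool → Maybe Bool
edgeLabel x y = if x xor y then just x else nothing

vertexLabel : ∀ {n} → Graph n → Graph n → Fin n → Label n
vertexLabel X Y v w = edgeLabel (adj X v w) (adj Y v w)

edgeLabel-∈∇ : ∀ {x y} → T (x xor y) → edgeLabel x y ≡ just x
edgeLabel-∈∇ {true}  {false} _ = refl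
edgeLabel-∈∇ {false} {true}  _ = refl

edgeLabel-∉∇ : ∀ {x y} → ¬ T (x xor y) → edgeLabel x y ≡ nothing
edgeLabel-∉∇ {true}  {true}  _ = refl
edgeLabel-∉∇ {true}  {false} ∉ = ⊥-elim (∉ tt)
edgeLabel-∉∇ {false} {true}  ∉ = ⊥-elim (∉ tt)
edgeLabel-∉∇ {false} {false} _ = refl

edgeLabel-nothing : ∀ {x y} → edgeLabel x y ≡ nothing → ¬ T (x xor y)
edgeLabel-nothing {true}  {true}  _ ()
edgeLabel-nothing {false} {false} _ ()

edgeLabel-just : ∀ {x y b} → edgeLabel x y ≡ just b → T (x xor y) × x ≡ b
edgeLabel-just {true}  {false} refl = tt , refl
edgeLabel-just {false} {true}  refl = tt , refl

#edgeLabel-true : ∀ x y → ⌊ edgeLabel x y ≟ₘ just true ⌋ ≡ x ∧ not y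
#edgeLabel-true true  true  = refl
#edgeLabel-true true  false = refl
#edgeLabel-true false true  = refl
#edgeLabel-true false false = refl

#edgeLabel-false : ∀ x y → ⌊ edgeLabel x y ≟ₘ just false ⌋ ≡ y ∧ not x
#edgeLabel-false true  true  = refl
#edgeLabel-false true  false = refl
#edgeLabel-false false true  = refl
#edgeLabel-false false false = refl

alternates⇒flip : ∀ {x x′} → (T x × ¬ T x′) ⊎ (¬ T x × T x′) → x′ ≡ not x
alternates⇒flip {true}  {false} _ = refl
alternates⇒flip {false} {true}  _ = refl
alternates⇒flip {true}  {true}  (inj₁ (_ , ¬x′)) = ⊥-elim (¬x′ tt)
alternates⇒flip {true}  {true}  (inj₂ (¬x , _)) = ⊥-elim (¬x tt)
alternates⇒flip {false} {false} (inj₁ (() , _))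
alternates⇒flip {false} {false} (inj₂ (_ , ()))

flip⇒alternates : ∀ {x x′} → x′ ≡ not x → (T x × ¬ T x′) ⊎ (¬ T x × T x′)
flip⇒alternates {true}  refl = inj₁ (tt , λ ())
flip⇒alternates {false} refl = inj₂ ((λ ()) , tt)

xor⇒not : ∀ {x y} → T (x xor y) → y ≡ not x
xor⇒not {true}  {false} _ = refl
xor⇒not {false} {true}  _ = refl

-- This is why alternation with respect to Y comes for free inside ∇ = E(X) △ E(Y).
xor-flip : ∀ {x y x′ y′} → T (x xor y) → T (x′ xor y′) → x′ ≡ not x → y′ ≡ not y
xor-flip {x} {y} {x′} {y′} ∈∇ ∈∇′ x′≡¬x = begin
  y′          ≡⟨ xor⇒not ∈∇′ ⟩
  not x′      ≡⟨ cong not x′≡¬x ⟩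
  not (not x) ≡⟨ cong not (xor⇒not ∈∇) ⟨
  not y       ∎
  where open ≡-Reasoning

module _ {n} (X Y : Graph n) (t : Table n) where

  private
    ValidRows : Set
    ValidRows = ∀ v → ValidRow (vertexLabel X Y v) true (lookup t v)

  validRows⇔InS : ValidRows ⇔ InS X Y t
  validRows⇔InS = mk⇔ to from
    where
    to : ValidRows → InS X Y t
    to V = (fixes-off-∇ , paired-in-∇)
         , alternating (adj X) (λ _ _ _ → proj₂ ∘ edgeLabel-just)
         , alternating (adj Y) (λ _ _ ∈∇ Lsw → let (∈∇′ , flipsX) = edgeLabel-just Lsw in xor-flip ∈∇ ∈∇′ flipsX)
      where
      fixes-off-∇ : ∀ v w → ¬ T (nabla X Y v w) → app t v w ≡ w
      fixes-off-∇ v w ∉∇ = fixes-unlabelled (V v) w (edgeLabel-∉∇ ∉∇)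
      paired-in-∇ : ∀ v w → T (nabla X Y v w) → T (nabla X Y v (app t v w)) × app t v (app t v w) ≡ w
      paired-in-∇ v w ∈∇ with on-labelled (V v) w (edgeLabel-∈∇ ∈∇)
      ... | inj₁ (_ , fixed , _) = subst (T ∘ nabla X Y v) (sym fixed) ∈∇ , trans (cong (app t v) fixed) fixed
      ... | inj₂ (Lsw , ssw) = proj₁ (edgeLabel-just Lsw) , ssw
      alternating : ∀ Z →
        (∀ v w → T (nabla X Y v w) → vertexLabel X Y v (app t v w) ≡ just (not (adj X v w)) →
           Z v (app t v w) ≡ not (Z v w)) →
        IsAlternating (nabla X Y) Z t
      alternating Z flips v w ∈∇ with on-labelled (V v) w (edgeLabel-∈∇ ∈∇)
      ... | inj₁ (_ , fixed , sole) = inj₁ (fixed , λ w′ ∈∇′ → sole w′ (edgeLabel-∈∇ ∈∇′))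
      ... | inj₂ (Lsw , _) = inj₂ (flip⇒alternates (flips v w ∈∇ Lsw))
    from : InS X Y t → ValidRows
    from ((fixes-off-∇ , paired-in-∇) , alternatingX , _) v = validRow unlabelled labelled
      where
      unlabelled : ∀ w → vertexLabel X Y v w ≡ nothing → app t v w ≡ w
      unlabelled w e = fixes-off-∇ v w (edgeLabel-nothing e)
      labelled : ∀ w {b} → vertexLabel X Y v w ≡ just b →
        (T true × SoleFixpoint (vertexLabel X Y v) (lookup t v) w) ⊎ Partnered (vertexLabel X Y v) (lookup t v) w b
      labelled w e with edgeLabel-just e
      ... | ∈∇ , refl with alternatingX v w ∈∇
      ...   | inj₁ (fixed , sole) = inj₁ (tt , fixed , λ w′ e′ → sole w′ (proj₁ (edgeLabel-just e′)))
      ...   | inj₂ alternates =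
        inj₂ (trans (edgeLabel-∈∇ (proj₁ (paired-in-∇ v w ∈∇))) (cong just (alternates⇒flip alternates)) ,
              proj₂ (paired-in-∇ v w ∈∇))

deg≤suc-deg : ∀ {n} {ℓ u : Fin n → ℕ} {X Y : Graph n} → Thin ℓ u → InG ℓ u X → InG ℓ u Y →
  ∀ v → deg X v ≤ suc (deg Y v)
deg≤suc-deg {ℓ = ℓ} {u} {X} {Y} thin X∈ Y∈ v = begin
  deg X v        ≤⟨ proj₂ (X∈ v) ⟩
  u v            ≤⟨ thin v ⟩
  ℓ v + 1        ≤⟨ +-monoˡ-≤ 1 (proj₁ (Y∈ v)) ⟩
  deg Y v + 1    ≡⟨ +-comm (deg Y v) 1 ⟩
  suc (deg Y v)  ∎
  where open ≤-Reasoning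

module _ {n} {ℓ u : Fin n → ℕ} (thin : Thin ℓ u) {X Y : Graph n} (X∈ : InG ℓ u X) (Y∈ : InG ℓ u Y) where

  hasCard-vertexRow : ∀ v → HasCard (ValidRow (vertexLabel X Y v) true) (⌈ degNabla X Y v /2⌉ !)
  hasCard-vertexRow v =
    subst (λ d → HasCard (ValidRow (vertexLabel X Y v) true) (⌈ d /2⌉ !)) (sym (countFin-xor x y))
      (hasCard-validRow #true #false
        (cancel-both (deg≤suc-deg {X = X} {Y} thin X∈ Y∈ v) X-deg Y-deg)
        (cancel-both (deg≤suc-deg {X = Y} {X} thin Y∈ X∈ v) Y-deg X-deg))
    where
    x = adj X v
    y = adj Y v
    onlyX = countFin λ w → x w ∧ not (y w)
    onlyY = countFin λ w → y w ∧ not (x w)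
    both  = countFin λ w → x w ∧ y w
    #true : #labels (vertexLabel X Y v) true ≡ onlyX
    #true = countFin-cong λ w → #edgeLabel-true (x w) (y w)
    #false : #labels (vertexLabel X Y v) false ≡ onlyY
    #false = countFin-cong λ w → #edgeLabel-false (x w) (y w)
    X-deg : deg X v ≡ both + onlyX
    X-deg = countFin-split x y
    Y-deg : deg Y v ≡ both + onlyY
    Y-deg = trans (countFin-split y x) (cong (_+ onlyY) (countFin-cong λ w → ∧-comm (y w) (x w)))
    cancel-both : ∀ {d d′ a b} → d ≤ suc d′ → d ≡ both + a → d′ ≡ both + b → a ≤ suc b
    cancel-both {a = a} {b} d≤1+d′ refl refl =
      +-cancelˡ-≤ both a (suc b) (subst (both + a ≤_) (sym (+-suc both b)) d≤1+d′)

lemma3p22 : (n : ℕ) (ℓ u : Fin n → ℕ) →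
    IsDegSeq ℓ → IsDegSeq u → ℓ ≤ᵖ u → Thin ℓ u →
    (X Y : Graph n) → InG ℓ u X → InG ℓ u Y →
    HasCard (InS X Y) (prodFin (λ v → ⌈ degNabla X Y v /2⌉ !))
lemma3p22 n ℓ u _ _ _ thin X Y X∈ Y∈ =
  hasCard-⇔ (validRows⇔InS X Y)
    (hasCard-Vec n (λ v → ValidRow (vertexLabel X Y v) true) (λ v → ⌈ degNabla X Y v /2⌉ !)
      (hasCard-vertexRow thin {X} {Y} X∈ Y∈))
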